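{- Let $G=(V,E)$ be a finite simple graph and let $B$ be a complete bipartite induced subgraph of $G$ with bipartition classes $B_X$ and $B_Y$. For $P\in\{B_X,B_Y\}$ let $Q=V(B)\setminus P$ and $M_1(P)=N_1(P)\cap N_2(Q)$. Then $B$ is a generating subgraph of $G$ if and only if there exists an independent subset of $N_2(V(B))$ which dominates $M_1(B_X)\cup M_1(B_Y)$.
   Context: For $S\subseteq V$ and $i\in\mathbb{N}$, $N_i(S)=\{u\in V:\min_{s\in S} d(u,s)=i\}$, where $d$ is the graph distance (length of a shortest path). A set is independent if no two of its vertices are adjacent. A set $S$ dominates a set $T$ if $S\cup N_1(S)\supseteq T$. A complete bipartite induced subgraph $B$ of $G$, with bipartition classes $B_X,B_Y$, is called generating if there is an independent set $S$ of $G$ such that both $S\cup B_X$ and $S\cup B_Y$ are maximal independent sets of $G$. -}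

module Defs where

open import Data.Nat using (ℕ; zero; suc; _<_)
open import Data.Fin using (Fin)
open import Data.Fin.Subset using (Subset; _∈_; _∉_; _⊆_; _∪_; _∩_; _─_; Nonempty; Empty)
open import Data.Product using (Σ; ∃; _×_; _,_)
open import Data.Sum using (_⊎_)
open import Relation.Nullary using (¬_; Dec)
open import Relation.Binary.PropositionalEquality using (_≡_)

record Graph : Set₁ where
  field
    n     : ℕ
    Adj   : Fin n → Fin n → Set
    adj?  : (u v : Fin n) → Dec (Adj u v)
    sym   : ∀ {u v} → Adj u v → Adj v u
    irrefl : ∀ {u} → ¬ Adj u u

module _ (G : Graph) where
  open Graph G

  V : Set
  V = Fin n

  data Walk : V → V → ℕ → Set where
    nil  : ∀ {u} → Walk u u zero
    cons : ∀ {u w v k} → Adj u w → Walk w v k → Walk u v (suc k)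

  -- u ∈ N_i(S):  min_{s ∈ S} d(u,s) = i,
  -- i.e. some s ∈ S is at distance exactly-reachable in i steps,
  -- and no s ∈ S reaches u in fewer than i steps.
  -- (The length of a shortest walk equals the length of a shortest path.)
  InN : ℕ → Subset n → V → Set
  InN i S u = (∃ λ s → s ∈ S × Walk s u i)
            × (∀ s → s ∈ S → ∀ j → j < i → ¬ Walk s u j)

  Independent : Subset n → Set
  Independent S = ∀ u v → u ∈ S → v ∈ S → ¬ Adj u v

  MaximalIndependent : Subset n → Set
  MaximalIndependent S =
    Independent S × (∀ T → Independent T → S ⊆ T → T ⊆ S)

  Dominates : Subset n → (V → Set) → Set
  Dominates S T = ∀ u → T u → u ∈ S ⊎ InN 1 S u

  -- B (with classes BX, BY) is a complete bipartite induced subgraph of G.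
  -- Both classes are nonempty (as for a complete bipartite graph K_{m,k}, m,k ≥ 1).
  CompleteBipartiteInduced : Subset n → Subset n → Set
  CompleteBipartiteInduced BX BY =
    Nonempty BX × Nonempty BY
    × (∀ u → u ∈ BX → u ∉ BY)
    × Independent BX × Independent BY
    × (∀ x y → x ∈ BX → y ∈ BY → Adj x y)

  Generating : Subset n → Subset n → Set
  Generating BX BY =
    ∃ λ S → Independent S
          × MaximalIndependent (S ∪ BX)
          × MaximalIndependent (S ∪ BY)

  InM1 : Subset n → Subset n → V → Set
  InM1 VB P u = InN 1 P u × InN 2 (VB ─ P) u

module Submission where

-- Module Sides then fixes an orientation (P, Q) of the bipartition and proves:
-- (⇒) if S ∪ P and S ∪ Q are maximal independent, S is far from B, and each
--     u ∈ M₁(P) has, by maximality of S ∪ Q, a neighbour w ∈ S; the path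
--     P – u – w places w in N₂(B), so S ∩ N₂(B) dominates M₁(P);
-- (⇐) if S dominates M₁(P) and S* ⊇ S covers all vertices far from B, then
--     S* ∪ Q covers every vertex: vertices of P or adjacent to Q by Q, those
--     of M₁(P) by S, and the remaining ones, far from B, by S*.

open import Defs
open import Data.Fin.Subset using (Subset; _∈_; _∪_)
open import Data.Product using (∃; _×_)
open import Data.Sum using (_⊎_)
open import Function.Bundles using (_⇔_)

open import Data.Nat using (zero; suc; _<_; s≤s; z≤n)
open import Data.Fin using (Fin)
open import Data.Fin.Subset using (_∉_; _⊆_; _─_; ⁅_⁆; Nonempty)
open import Data.Fin.Subset.Properties
  using (_∈?_; x∈p∪q⁻; x∈p∪q⁺; x∈⁅y⁆⇒x≡y; x∈⁅x⁆; p─q⊆p; x∈p∧x∉q⇒x∈p─q)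
open import Data.Fin.Properties using (any?)
open import Data.Product using (_,_; proj₁; proj₂)
open import Data.Sum using (inj₁; inj₂; [_,_]′) renaming (swap to ⊎-swap)
open import Data.Empty using (⊥-elim)
open import Data.List using (List; []; _∷_; _++_; allFin)
open import Data.List.Membership.Propositional using () renaming (_∈_ to _∈ₗ_)
open import Data.List.Membership.Propositional.Properties using (∈-allFin; ∈-++⁻)
import Data.List.Relation.Unary.Any as ListAny
open import Data.Vec using (tabulate; _∷_)
open import Data.Vec.Base using (here; there)
open import Data.Vec.Properties using (lookup∘tabulate; lookup⇒[]=; []=⇒lookup)
open import Relation.Nullary using (¬_; yes; no; does)
open import Relation.Nullary.Decidable using (_×-dec_; ¬?; dec-true; map′)
open import Level using (0ℓ)
open import Relation.Unary using (Pred; Decidable)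
open import Relation.Binary.PropositionalEquality using (refl; sym; trans)
open import Function.Bundles using (mk⇔; Equivalence)
open Equivalence using (to; from)

x∈p─q⇒x∉q : ∀ {m} {p q : Subset m} {x : Fin m} → x ∈ p ─ q → x ∉ q
x∈p─q⇒x∉q {p = _ ∷ _} {_ ∷ _} (there x∈p─q) (there x∈q) = x∈p─q⇒x∉q x∈p─q x∈q

module GraphFacts (G : Graph) where
  open Graph G renaming (sym to adj-sym)

  ⟦_⟧ : {P : Pred (V G) 0ℓ} → Decidable P → Subset n
  ⟦ P? ⟧ = tabulate (λ u → does (P? u))

  ∈⟦⟧⇔ : {P : Pred (V G) 0ℓ} (P? : Decidable P) {u : V G} → u ∈ ⟦ P? ⟧ ⇔ P u
  ∈⟦⟧⇔ {P} P? {u} = mk⇔ sound complete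
    where
    sound : u ∈ ⟦ P? ⟧ → P u
    sound u∈ with P? u | trans (sym (lookup∘tabulate _ u)) ([]=⇒lookup u∈)
    ... | yes Pu | _  = Pu
    ... | no _   | ()

    complete : P u → u ∈ ⟦ P? ⟧
    complete Pu = lookup⇒[]= u _ (trans (lookup∘tabulate _ u) (dec-true (P? u) Pu))

  HasNbrIn : Subset n → V G → Set
  HasNbrIn S u = ∃ λ s → s ∈ S × Adj s u

  HasNbrIn? : (S : Subset n) → Decidable (HasNbrIn S)
  HasNbrIn? S u = any? (λ s → s ∈? S ×-dec adj? s u)

  Far : Subset n → V G → Set
  Far S u = u ∉ S × ¬ HasNbrIn S u

  Far? : (S : Subset n) → Decidable (Far S)
  Far? S u = ¬? (u ∈? S) ×-dec ¬? (HasNbrIn? S u)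

  Covers : Subset n → V G → Set
  Covers S u = u ∈ S ⊎ HasNbrIn S u

  nbr-mono : ∀ {S T u} → S ⊆ T → HasNbrIn S u → HasNbrIn T u
  nbr-mono S⊆T (s , s∈S , s~u) = s , S⊆T s∈S , s~u

  covers-mono : ∀ {S T u} → S ⊆ T → Covers S u → Covers T u
  covers-mono S⊆T (inj₁ u∈S) = inj₁ (S⊆T u∈S)
  covers-mono S⊆T (inj₂ nbr) = inj₂ (nbr-mono S⊆T nbr)

  far-anti : ∀ {S T u} → T ⊆ S → Far S u → Far T u
  far-anti T⊆S (u∉S , no-nbr) = (λ u∈T → u∉S (T⊆S u∈T)) , (λ nbr → no-nbr (nbr-mono T⊆S nbr))

  N₁⇔ : ∀ {S u} → InN G 1 S u ⇔ (u ∉ S × HasNbrIn S u)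
  N₁⇔ {S} {u} = mk⇔ split join
    where
    split : InN G 1 S u → u ∉ S × HasNbrIn S u
    split ((s , s∈S , cons s~u nil) , shorter) =
      (λ u∈S → shorter u u∈S 0 (s≤s z≤n) nil) , (s , s∈S , s~u)

    join : u ∉ S × HasNbrIn S u → InN G 1 S u
    join (u∉S , s , s∈S , s~u) = (s , s∈S , cons s~u nil) , shorter
      where
      shorter : ∀ t → t ∈ S → ∀ j → j < 1 → ¬ Walk G t u j
      shorter t t∈S zero _ nil = u∉S t∈S
      shorter _ _ (suc _) (s≤s ())

  N₂⇔ : ∀ {S u} → InN G 2 S u ⇔ (Far S u × ∃ λ w → HasNbrIn S w × Adj w u)
  N₂⇔ {S} {u} = mk⇔ split join
    where
    split : InN G 2 S u → Far S u × ∃ λ w → HasNbrIn S w × Adj w u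
    split ((s , s∈S , cons s~w (cons w~u nil)) , shorter) =
      ( (λ u∈S → shorter u u∈S 0 (s≤s z≤n) nil)
      , (λ (t , t∈S , t~u) → shorter t t∈S 1 (s≤s (s≤s z≤n)) (cons t~u nil)) )
      , _ , (s , s∈S , s~w) , w~u

    join : Far S u × (∃ λ w → HasNbrIn S w × Adj w u) → InN G 2 S u
    join ((u∉S , no-nbr) , w , (s , s∈S , s~w) , w~u) =
      (s , s∈S , cons s~w (cons w~u nil)) , shorter
      where
      shorter : ∀ t → t ∈ S → ∀ j → j < 2 → ¬ Walk G t u j
      shorter t t∈S zero    _ nil               = u∉S t∈S
      shorter t t∈S (suc 0) _ (cons t~u nil)    = no-nbr (t , t∈S , t~u)
      shorter t t∈S (suc (suc _)) (s≤s (s≤s ()))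

  N₂? : (S : Subset n) → Decidable (InN G 2 S)
  N₂? S u = map′ (from N₂⇔) (to N₂⇔)
    (Far? S u ×-dec any? (λ w → HasNbrIn? S w ×-dec adj? w u))

  _∩N₂_ : Subset n → Subset n → Subset n
  S ∩N₂ B = ⟦ (λ u → u ∈? S ×-dec N₂? B u) ⟧

  ∈∩N₂⇔ : ∀ {S B u} → u ∈ S ∩N₂ B ⇔ (u ∈ S × InN G 2 B u)
  ∈∩N₂⇔ {S} {B} = ∈⟦⟧⇔ (λ u → u ∈? S ×-dec N₂? B u)

  dominated⇒covered : ∀ {S u} → u ∈ S ⊎ InN G 1 S u → Covers S u
  dominated⇒covered = [ inj₁ , (λ u∈N₁S → inj₂ (proj₂ (to N₁⇔ u∈N₁S))) ]′

  independent-∪ : ∀ {S T} → Independent G S → Independent G T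
                → (∀ s t → s ∈ S → t ∈ T → ¬ Adj s t) → Independent G (S ∪ T)
  independent-∪ {S} {T} indS indT apart a b a∈ b∈
    with x∈p∪q⁻ S T a∈ | x∈p∪q⁻ S T b∈
  ... | inj₁ a∈S | inj₁ b∈S = indS a b a∈S b∈S
  ... | inj₁ a∈S | inj₂ b∈T = apart a b a∈S b∈T
  ... | inj₂ a∈T | inj₁ b∈S = λ a~b → apart b a b∈S a∈T (adj-sym a~b)
  ... | inj₂ a∈T | inj₂ b∈T = indT a b a∈T b∈T

  independent-insert : ∀ {S v} → Independent G S → ¬ HasNbrIn S v
                     → Independent G (⁅ v ⁆ ∪ S)
  independent-insert {S} {v} indS no-nbr = independent-∪ single indS apart
    where
    single : Independent G ⁅ v ⁆
    single a b a∈ b∈ rewrite x∈⁅y⁆⇒x≡y v a∈ | x∈⁅y⁆⇒x≡y v b∈ = irrefl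

    apart : ∀ s t → s ∈ ⁅ v ⁆ → t ∈ S → ¬ Adj s t
    apart s t s∈ t∈S s~t rewrite x∈⁅y⁆⇒x≡y v s∈ = no-nbr (t , t∈S , adj-sym s~t)

  independent-⊆ : ∀ {S T} → S ⊆ T → Independent G T → Independent G S
  independent-⊆ S⊆T indT a b a∈ b∈ = indT a b (S⊆T a∈) (S⊆T b∈)

  maximal⇔covering : ∀ {I} → MaximalIndependent G I ⇔ (Independent G I × ∀ v → Covers I v)
  maximal⇔covering {I} = mk⇔ (λ (indI , maxI) → indI , covering indI maxI) maximal
    where
    covering : Independent G I → (∀ T → Independent G T → I ⊆ T → T ⊆ I)
             → ∀ v → Covers I v
    covering indI maxI v with v ∈? I | HasNbrIn? I v
    ... | yes v∈I | _        = inj₁ v∈I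
    ... | no _    | yes nbr  = inj₂ nbr
    ... | no v∉I  | no no-nbr =
      ⊥-elim (v∉I (maxI (⁅ v ⁆ ∪ I) (independent-insert indI no-nbr)
                        (λ u∈I → x∈p∪q⁺ (inj₂ u∈I)) (x∈p∪q⁺ (inj₁ (x∈⁅x⁆ v)))))

    maximal : Independent G I × (∀ v → Covers I v) → MaximalIndependent G I
    maximal (indI , covered) = indI , absorbed
      where
      absorbed : ∀ T → Independent G T → I ⊆ T → T ⊆ I
      absorbed T indT I⊆T {u} u∈T with covered u
      ... | inj₁ u∈I             = u∈I
      ... | inj₂ (s , s∈I , s~u) = ⊥-elim (indT s u (I⊆T s∈I) u∈T s~u)

  record Extension (W : Pred (V G) 0ℓ) (S : Subset n) (vs : List (V G)) : Set where
    field
      carrier     : Subset n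
      grows       : S ⊆ carrier
      independent : Independent G carrier
      admissible  : ∀ {u} → u ∈ carrier → W u
      covers      : ∀ {v} → v ∈ₗ vs → W v → Covers carrier v

  module Greedy {W : Pred (V G) 0ℓ} (W? : Decidable W) where

    _▷_ : ∀ {S vs ws} (E : Extension W S vs)
        → Extension W (Extension.carrier E) ws → Extension W S (vs ++ ws)
    _▷_ {vs = vs} E F = record
      { carrier     = F.carrier
      ; grows       = λ u∈S → F.grows (E.grows u∈S)
      ; independent = F.independent
      ; admissible  = F.admissible
      ; covers      = λ v∈ Wv →
          [ (λ v∈vs → covers-mono F.grows (E.covers v∈vs Wv))
          , (λ v∈ws → F.covers v∈ws Wv) ]′ (∈-++⁻ vs v∈)
      }
      where
      module E = Extension E
      module F = Extension F

    covering-by : ∀ {S v} C → S ⊆ C → Independent G C → (∀ {u} → u ∈ C → W u)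
                → (W v → Covers C v) → Extension W S (v ∷ [])
    covering-by C S⊆C indC admC cov = record
      { carrier = C ; grows = S⊆C ; independent = indC ; admissible = admC
      ; covers = λ { (ListAny.here refl) → cov } }

    extend-by : ∀ {S} v → Independent G S → (∀ {u} → u ∈ S → W u)
              → Extension W S (v ∷ [])
    extend-by {S} v indS admS with W? v | HasNbrIn? S v
    ... | no ¬Wv | _         = covering-by S (λ u∈S → u∈S) indS admS (λ Wv → ⊥-elim (¬Wv Wv))
    ... | yes _  | yes nbr   = covering-by S (λ u∈S → u∈S) indS admS (λ _ → inj₂ nbr)
    ... | yes Wv | no no-nbr =
      covering-by (⁅ v ⁆ ∪ S) (λ u∈S → x∈p∪q⁺ (inj₂ u∈S))
        (independent-insert indS no-nbr) admissible (λ _ → inj₁ (x∈p∪q⁺ (inj₁ (x∈⁅x⁆ v))))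
      where
      admissible : ∀ {u} → u ∈ ⁅ v ⁆ ∪ S → W u
      admissible u∈ with x∈p∪q⁻ ⁅ v ⁆ S u∈
      ... | inj₁ u∈⁅v⁆ rewrite x∈⁅y⁆⇒x≡y v u∈⁅v⁆ = Wv
      ... | inj₂ u∈S = admS u∈S

    extend : ∀ {S} vs → Independent G S → (∀ {u} → u ∈ S → W u) → Extension W S vs
    extend {S} [] indS admS = record
      { carrier = S ; grows = λ u∈S → u∈S ; independent = indS ; admissible = admS
      ; covers = λ () }
    extend (v ∷ vs) indS admS = E ▷ extend vs (Extension.independent E) (Extension.admissible E)
      where
      E = extend-by v indS admS

  module Sides {B P Q : Subset n}
    (B⇔P⊎Q   : ∀ {u} → u ∈ B ⇔ (u ∈ P ⊎ u ∈ Q))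
    (P-nonempty : Nonempty P) (Q-nonempty : Nonempty Q)
    (Q∩P=∅    : ∀ u → u ∈ Q → u ∉ P)
    (indQ     : Independent G Q)
    (complete : ∀ p q → p ∈ P → q ∈ Q → Adj p q)
    where

    P⊆B : P ⊆ B
    P⊆B p∈P = from B⇔P⊎Q (inj₁ p∈P)

    Q⊆B : Q ⊆ B
    Q⊆B q∈Q = from B⇔P⊎Q (inj₂ q∈Q)

    B─P⇔Q : ∀ {u} → u ∈ B ─ P ⇔ u ∈ Q
    B─P⇔Q {u} = mk⇔ inQ (λ u∈Q → x∈p∧x∉q⇒x∈p─q (Q⊆B u∈Q) (Q∩P=∅ u u∈Q))
      where
      inQ : u ∈ B ─ P → u ∈ Q
      inQ u∈B─P with to B⇔P⊎Q (p─q⊆p B P u∈B─P)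
      ... | inj₁ u∈P = ⊥-elim (x∈p─q⇒x∉q u∈B─P u∈P)
      ... | inj₂ u∈Q = u∈Q

    far-from-sides : ∀ {u} → Far P u → Far Q u → Far B u
    far-from-sides (u∉P , no-P) (u∉Q , no-Q) =
      (λ u∈B → [ u∉P , u∉Q ]′ (to B⇔P⊎Q u∈B))
      , (λ (b , b∈B , b~u) → [ (λ b∈P → no-P (b , b∈P , b~u)) , (λ b∈Q → no-Q (b , b∈Q , b~u)) ]′
                               (to B⇔P⊎Q b∈B))

    -- If both S ∪ P and S ∪ Q are independent, every vertex of S is far
    -- from B: each side is adjacent to all of the other side.
    far-from-B : ∀ {S s} → Independent G (S ∪ P) → Independent G (S ∪ Q) → s ∈ S → Far B s
    far-from-B {S} {s} indSP indSQ s∈S = s∉B , no-nbr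
      where
      s∉B : s ∉ B
      s∉B s∈B with to B⇔P⊎Q s∈B
      ... | inj₁ s∈P = let (q , q∈Q) = Q-nonempty in
        indSQ s q (x∈p∪q⁺ (inj₁ s∈S)) (x∈p∪q⁺ (inj₂ q∈Q)) (complete s q s∈P q∈Q)
      ... | inj₂ s∈Q = let (p , p∈P) = P-nonempty in
        indSP p s (x∈p∪q⁺ (inj₂ p∈P)) (x∈p∪q⁺ (inj₁ s∈S)) (complete p s p∈P s∈Q)

      no-nbr : ¬ HasNbrIn B s
      no-nbr (b , b∈B , b~s) with to B⇔P⊎Q b∈B
      ... | inj₁ b∈P = indSP b s (x∈p∪q⁺ (inj₂ b∈P)) (x∈p∪q⁺ (inj₁ s∈S)) b~s
      ... | inj₂ b∈Q = indSQ b s (x∈p∪q⁺ (inj₂ b∈Q)) (x∈p∪q⁺ (inj₁ s∈S)) b~s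

    M₁-intro : ∀ {u} → HasNbrIn P u → u ∉ P → Far Q u → InM1 G B P u
    M₁-intro {u} nbrP@(p , p∈P , p~u) u∉P far-Q =
      from N₁⇔ (u∉P , nbrP) ,
      from N₂⇔ (far-anti (to B─P⇔Q) far-Q , p , (q₀ , from B─P⇔Q q₀∈Q , q₀~p) , p~u)
      where
      q₀ = proj₁ Q-nonempty
      q₀∈Q = proj₂ Q-nonempty
      q₀~p = adj-sym (complete p q₀ p∈P q₀∈Q)

    M₁-witness : ∀ {S u} → Independent G (S ∪ P) → MaximalIndependent G (S ∪ Q)
               → InM1 G B P u → u ∉ S × ∃ λ w → (w ∈ S × InN G 2 B w) × Adj w u
    M₁-witness {S} {u} indSP maxSQ (u∈N₁P , u∈N₂Q) =
      u∉S , neighbour (proj₂ (to maximal⇔covering maxSQ) u)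
      where
      nbrP : HasNbrIn P u
      nbrP = proj₂ (to N₁⇔ u∈N₁P)

      far-Q : Far Q u
      far-Q = far-anti (from B─P⇔Q) (proj₁ (to N₂⇔ u∈N₂Q))

      u∉S : u ∉ S
      u∉S u∈S = let (x , x∈P , x~u) = nbrP in
        indSP x u (x∈p∪q⁺ (inj₂ x∈P)) (x∈p∪q⁺ (inj₁ u∈S)) x~u

      neighbour : Covers (S ∪ Q) u → ∃ λ w → (w ∈ S × InN G 2 B w) × Adj w u
      neighbour (inj₁ u∈S∪Q) = ⊥-elim ([ u∉S , proj₁ far-Q ]′ (x∈p∪q⁻ S Q u∈S∪Q))
      neighbour (inj₂ (w , w∈S∪Q , w~u)) with x∈p∪q⁻ S Q w∈S∪Q
      ... | inj₂ w∈Q = ⊥-elim (proj₂ far-Q (w , w∈Q , w~u))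
      ... | inj₁ w∈S = w , (w∈S , w∈N₂B) , w~u
        where
        w∈N₂B : InN G 2 B w
        w∈N₂B = from N₂⇔ (far-from-B indSP (proj₁ maxSQ) w∈S , u , nbr-mono P⊆B nbrP , adj-sym w~u)

    M₁-dominated : ∀ {S u} → Independent G (S ∪ P) → MaximalIndependent G (S ∪ Q)
                 → InM1 G B P u → u ∈ S ∩N₂ B ⊎ InN G 1 (S ∩N₂ B) u
    M₁-dominated indSP maxSQ u∈M₁ =
      let (u∉S , w , w∈S∩N₂B , w~u) = M₁-witness indSP maxSQ u∈M₁ in
      inj₂ (from N₁⇔ ( (λ u∈ → u∉S (proj₁ (to ∈∩N₂⇔ u∈)))
                     , w , from ∈∩N₂⇔ w∈S∩N₂B , w~u))

    generates : ∀ {S} (E : Extension (Far B) S (allFin n)) → (∀ u → InM1 G B P u → Covers S u)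
              → MaximalIndependent G (Extension.carrier E ∪ Q)
    generates E M₁-covered =
      from maximal⇔covering (independent-∪ independent indQ apart , covered)
      where
      open Extension E

      left : carrier ⊆ carrier ∪ Q
      left s∈ = x∈p∪q⁺ (inj₁ s∈)

      right : Q ⊆ carrier ∪ Q
      right q∈Q = x∈p∪q⁺ (inj₂ q∈Q)

      apart : ∀ s q → s ∈ carrier → q ∈ Q → ¬ Adj s q
      apart s q s∈ q∈Q s~q = proj₂ (admissible s∈) (q , Q⊆B q∈Q , adj-sym s~q)

      covered : ∀ v → Covers (carrier ∪ Q) v
      covered v with v ∈? Q | v ∈? P | HasNbrIn? Q v | HasNbrIn? P v
      ... | yes v∈Q | _       | _       | _ = inj₁ (right v∈Q)
      ... | no _    | yes v∈P | _       | _ =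
        let (q₀ , q₀∈Q) = Q-nonempty in inj₂ (q₀ , right q₀∈Q , adj-sym (complete v q₀ v∈P q₀∈Q))
      ... | no _    | no _    | yes nbrQ | _ = inj₂ (nbr-mono right nbrQ)
      ... | no v∉Q  | no v∉P  | no ¬nbrQ | yes nbrP =
        covers-mono (λ s∈S → left (grows s∈S)) (M₁-covered v (M₁-intro nbrP v∉P (v∉Q , ¬nbrQ)))
      ... | no v∉Q  | no v∉P  | no ¬nbrQ | no ¬nbrP =
        covers-mono left (covers (∈-allFin v) (far-from-sides (v∉P , ¬nbrP) (v∉Q , ¬nbrQ)))

proposition1 : (G : Graph) → (BX BY : Subset (Graph.n G))
    → CompleteBipartiteInduced G BX BY
    → Generating G BX BY
    ⇔ (∃ λ S → (∀ u → u ∈ S → InN G 2 (BX ∪ BY) u)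
    × Independent G S
    × Dominates G S (λ u → InM1 G (BX ∪ BY) BX u ⊎ InM1 G (BX ∪ BY) BY u))
proposition1 G BX BY (BX≠∅ , BY≠∅ , BX∩BY=∅ , indBX , indBY , complete) =
  mk⇔ necessary sufficient
  where
  open Graph G using (n) renaming (sym to adj-sym)
  open GraphFacts G

  B = BX ∪ BY

  module X = Sides {B} {BX} {BY} (mk⇔ (x∈p∪q⁻ BX BY) x∈p∪q⁺)
    BX≠∅ BY≠∅ (λ u u∈BY u∈BX → BX∩BY=∅ u u∈BX u∈BY) indBY complete
  module Y = Sides {B} {BY} {BX} (mk⇔ (λ u∈B → ⊎-swap (x∈p∪q⁻ BX BY u∈B)) (λ u∈ → x∈p∪q⁺ (⊎-swap u∈)))
    BY≠∅ BX≠∅ BX∩BY=∅ indBX (λ y x y∈BY x∈BX → adj-sym (complete x y x∈BX y∈BY))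

  DominatingSet : Set
  DominatingSet = ∃ λ S → (∀ u → u ∈ S → InN G 2 B u) × Independent G S
                        × Dominates G S (λ u → InM1 G B BX u ⊎ InM1 G B BY u)

  necessary : Generating G BX BY → DominatingSet
  necessary (S , indS , maxSX , maxSY) =
    S ∩N₂ B , (λ u u∈ → proj₂ (to ∈∩N₂⇔ u∈))
    , independent-⊆ (λ u∈ → proj₁ (to ∈∩N₂⇔ u∈)) indS
    , λ u → [ X.M₁-dominated (proj₁ maxSX) maxSY , Y.M₁-dominated (proj₁ maxSY) maxSX ]′

  -- A greedy enlargement of S among the vertices far from B generates B.
  sufficient : DominatingSet → Generating G BX BY
  sufficient (S , S⊆N₂B , indS , dominates) =
    carrier , independent
    , Y.generates E (λ u u∈M₁ → dominated⇒covered (dominates u (inj₂ u∈M₁)))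
    , X.generates E (λ u u∈M₁ → dominated⇒covered (dominates u (inj₁ u∈M₁)))
    where
    E = Greedy.extend (Far? B) (allFin n) indS (λ u∈S → proj₁ (to N₂⇔ (S⊆N₂B _ u∈S)))
    open Extension E
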